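{- Let $\mathbf{A}$ be a Heyting algebra and $a\in\mathbf{A}$. If $(\neg\neg a\to a)\to(\neg\neg a\lor\neg a)=\mathbf{1}$ and $\neg a\lor\neg\neg a\neq\mathbf{1}$, then the subalgebra of $\mathbf{A}$ generated by $a$ is isomorphic to $\mathbf{Z}_7$.
   Context: Heyting algebras are algebras $(A;\land,\lor,\to,\neg)$ with $(A;\land,\lor)$ a bounded distributive lattice, $\to$ the relative pseudocomplement and $\neg x=x\to\mathbf{0}$. For each finite $n\geq1$, $\mathbf{Z}_n$ denotes the (unique up to isomorphism) one-generated Heyting algebra with exactly $n$ elements; $\mathbf{Z}_7$ is lattice-isomorphic to the six-element lattice $\mathbf{2}\times\mathbf{3}$ with a new top element added. -}

module Defs where

open import Level using (Level)
open import Data.Bool using (Bool; true; false; if_then_else_) renaming (_∧_ to _∧ᵇ_; _∨_ to _∨ᵇ_)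
open import Data.Product using (Σ; _×_)
open import Relation.Binary.PropositionalEquality using (_≡_)
open import Relation.Binary.Lattice.Bundles using (HeytingAlgebra)

data Term : Set where
  var  : Term
  ⊥ₜ ⊤ₜ : Term
  _∧ₜ_ _∨ₜ_ _⇨ₜ_ : Term → Term → Term
  ¬ₜ_  : Term → Term

module _ {c ℓ₁ ℓ₂ : Level} (H : HeytingAlgebra c ℓ₁ ℓ₂) where
  open HeytingAlgebra H

  neg : Carrier → Carrier
  neg x = x ⇨ ⊥

  -- value of a term at a; the subalgebra generated by a is the set of
  -- all such values
  eval : Carrier → Term → Carrier
  eval a var       = a
  eval a ⊥ₜ        = ⊥
  eval a ⊤ₜ        = ⊤
  eval a (s ∧ₜ t)  = eval a s ∧ eval a t
  eval a (s ∨ₜ t)  = eval a s ∨ eval a t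
  eval a (s ⇨ₜ t)  = eval a s ⇨ eval a t
  eval a (¬ₜ t)    = neg (eval a t)

-- The Heyting algebra Z₇: the lattice 2 × 3 with a new top added.

data Three : Set where
  l0 l1 l2 : Three

min₃ : Three → Three → Three
min₃ l0 _  = l0
min₃ l1 l0 = l0
min₃ l1 _  = l1
min₃ l2 y  = y

max₃ : Three → Three → Three
max₃ l0 y  = y
max₃ l1 l2 = l2
max₃ l1 _  = l1
max₃ l2 _  = l2

leq₃ : Three → Three → Bool
leq₃ l0 _  = true
leq₃ l1 l0 = false
leq₃ l1 _  = true
leq₃ l2 l2 = true
leq₃ l2 _  = false

imp₃ : Three → Three → Three
imp₃ x y = if leq₃ x y then l2 else y

leq₂ : Bool → Bool → Bool
leq₂ true false = false
leq₂ _    _     = true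

imp₂ : Bool → Bool → Bool
imp₂ x y = if leq₂ x y then true else y

data Z7 : Set where
  pt  : Bool → Three → Z7
  top : Z7

meetZ : Z7 → Z7 → Z7
meetZ top y = y
meetZ (pt a b) top = pt a b
meetZ (pt a b) (pt c d) = pt (a ∧ᵇ c) (min₃ b d)

joinZ : Z7 → Z7 → Z7
joinZ top y = top
joinZ (pt a b) top = top
joinZ (pt a b) (pt c d) = pt (a ∨ᵇ c) (max₃ b d)

impZ : Z7 → Z7 → Z7
impZ x top = top
impZ top y = y
impZ (pt a b) (pt c d) =
  if leq₂ a c ∧ᵇ leq₃ b d then top else pt (imp₂ a c) (imp₃ b d)

botZ : Z7
botZ = pt false l0

-- "The subalgebra of H generated by a is isomorphic to Z₇":
-- an injective Heyting-algebra homomorphism f : Z₇ → H whose image is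
-- exactly the subalgebra generated by a.

record GeneratedIsoZ7 {c ℓ₁ ℓ₂ : Level} (H : HeytingAlgebra c ℓ₁ ℓ₂)
                      (a : HeytingAlgebra.Carrier H) : Set (c Level.⊔ ℓ₁) where
  open HeytingAlgebra H
  field
    f       : Z7 → Carrier
    f-∧     : ∀ x y → f (meetZ x y) ≈ (f x ∧ f y)
    f-∨     : ∀ x y → f (joinZ x y) ≈ (f x ∨ f y)
    f-⇨     : ∀ x y → f (impZ x y) ≈ (f x ⇨ f y)
    f-⊤     : f top ≈ ⊤
    f-⊥     : f botZ ≈ ⊥
    f-inj   : ∀ x y → f x ≈ f y → x ≡ y
    f-onto  : ∀ t → Σ Z7 (λ z → eval H a t ≈ f z)
    f-into  : ∀ z → Σ Term (λ t → eval H a t ≈ f z)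

{-# OPTIONS --safe #-}
-- Write w = ¬a ∨ ¬¬a. Since ¬a ∧ ¬¬a = 0, distributivity makes (x , y) ↦ x ∨ y an
-- embedding of the lattice {0, ¬a} × {0, a, ¬¬a} ≅ 2 × 3 into the interval [0, w], with
-- inverse u ↦ (¬a ∧ u , ¬¬a ∧ u); adding 1 gives a copy ι of Z₇ containing a, closed
-- under ∧ and ∨. For x ≰ y in this copy the implication x ⇨ y lies below w (for
-- ¬¬a ⇨ a this is the first hypothesis), so it is determined by its two coordinates,
-- which are the relative implications ¬a ∧ (x ⇨ y) and ¬¬a ∧ (x ⇨ y) computed in the
-- chains. The second hypothesis, w ≠ 1, keeps the seven elements distinct.
module Submission where

open import Defs
open import Relation.Nullary using (¬_; contradiction)
open import Relation.Binary.Core using (_Preserves₂_⟶_⟶_)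
open import Relation.Binary.Lattice.Bundles using (HeytingAlgebra)
open import Data.Bool using (Bool; true; false) renaming (_∧_ to _∧ᵇ_; _∨_ to _∨ᵇ_)
open import Data.Bool.Properties using (∧-conicalˡ; ∧-conicalʳ)
open import Data.Product using (Σ; _,_)
import Relation.Binary.PropositionalEquality as ≡
open ≡ using (_≡_)

module HeytingAlgebraLemmas {c ℓ₁ ℓ₂} (H : HeytingAlgebra c ℓ₁ ℓ₂) where
  open HeytingAlgebra H
  open import Relation.Binary.Lattice.Properties.HeytingAlgebra H
    using (⇨-eval; ⇨-applyˡ; ∧-distribˡ-∨; distributiveLattice)
  open import Relation.Binary.Lattice.Properties.DistributiveLattice distributiveLattice
    using (∧-distribʳ-∨)
  open import Relation.Binary.Lattice.Properties.MeetSemilattice meetSemilattice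
    using (∧-comm; ∧-cong; ∧-monotonic)
  open import Relation.Binary.Lattice.Properties.JoinSemilattice joinSemilattice
    using (∨-cong; ∨-monotonic)
  open import Relation.Binary.Lattice.Properties.BoundedJoinSemilattice boundedJoinSemilattice
    using () renaming (identityˡ to ∨-identityˡ; identityʳ to ∨-identityʳ)
  open import Relation.Binary.Lattice.Properties.BoundedMeetSemilattice boundedMeetSemilattice
    using () renaming (identityʳ to ∧-identityʳ)
  open import Relation.Binary.Reasoning.PartialOrder poset

  x≤y⇒x⇨y≈⊤ : ∀ {x y} → x ≤ y → x ⇨ y ≈ ⊤
  x≤y⇒x⇨y≈⊤ x≤y = antisym (maximum _) (transpose-⇨ (trans (x∧y≤y _ _) x≤y))

  x⇨y≈⊤⇒x≤y : ∀ {x y} → x ⇨ y ≈ ⊤ → x ≤ y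
  x⇨y≈⊤⇒x≤y x⇨y≈⊤ =
    trans (∧-greatest (maximum _) refl) (transpose-∧ (reflexive (Eq.sym x⇨y≈⊤)))

  ⊤⇨x≈x : ∀ {x} → ⊤ ⇨ x ≈ x
  ⊤⇨x≈x = antisym (trans (reflexive (Eq.sym (∧-identityʳ _))) ⇨-eval)
                  (transpose-⇨ (x∧y≤x _ _))

  x≤y⇒p∧[x⇨y]≈p : ∀ {p x y} → x ≤ y → p ≈ p ∧ (x ⇨ y)
  x≤y⇒p∧[x⇨y]≈p {p} x≤y = begin-equality
    p           ≈⟨ ∧-identityʳ p ⟨
    p ∧ ⊤       ≈⟨ ∧-cong Eq.refl (x≤y⇒x⇨y≈⊤ x≤y) ⟨
    p ∧ (_ ⇨ _) ∎

  ⇨-restrict : ∀ {p q x y} → p ≤ x → p ∧ y ≤ q → x ⇨ y ≤ p ⇨ q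
  ⇨-restrict p≤x p∧y≤q = transpose-⇨ (trans (∧-greatest (x∧y≤y _ _) (⇨-applyˡ p≤x)) p∧y≤q)

  ∧-∨-disjointˡ : ∀ {p q x y} → p ∧ q ≤ ⊥ → x ≤ p → y ≤ q → p ∧ (x ∨ y) ≈ x
  ∧-∨-disjointˡ {p} {q} {x} {y} p∧q≤⊥ x≤p y≤q = antisym
    (begin
      p ∧ (x ∨ y)     ≈⟨ ∧-distribˡ-∨ p x y ⟩
      p ∧ x ∨ p ∧ y   ≤⟨ ∨-monotonic (x∧y≤y p x) (trans (∧-monotonic refl y≤q) p∧q≤⊥) ⟩
      x ∨ ⊥           ≈⟨ ∨-identityʳ x ⟩
      x               ∎)
    (∧-greatest x≤p (x≤x∨y x y))

  ∧-∨-disjointʳ : ∀ {p q x y} → p ∧ q ≤ ⊥ → x ≤ p → y ≤ q → q ∧ (x ∨ y) ≈ y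
  ∧-∨-disjointʳ {p} {q} {x} {y} p∧q≤⊥ x≤p y≤q = antisym
    (begin
      q ∧ (x ∨ y)     ≈⟨ ∧-distribˡ-∨ q x y ⟩
      q ∧ x ∨ q ∧ y   ≤⟨ ∨-monotonic q∧x≤⊥ (x∧y≤y q y) ⟩
      ⊥ ∨ y           ≈⟨ ∨-identityˡ y ⟩
      y               ∎)
    (∧-greatest y≤q (y≤x∨y x y))
    where
    q∧x≤⊥ : q ∧ x ≤ ⊥
    q∧x≤⊥ = trans (∧-greatest (trans (x∧y≤y q x) x≤p) (x∧y≤x q x)) p∧q≤⊥

  ∧-∨-interchange-disjoint : ∀ {p q r s} → p ∧ s ≤ ⊥ → r ∧ q ≤ ⊥ →
                             (p ∨ q) ∧ (r ∨ s) ≈ p ∧ r ∨ q ∧ s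
  ∧-∨-interchange-disjoint {p} {q} {r} {s} p∧s≤⊥ r∧q≤⊥ = antisym
    (begin
      (p ∨ q) ∧ (r ∨ s)                 ≈⟨ ∧-distribˡ-∨ _ r s ⟩
      (p ∨ q) ∧ r ∨ (p ∨ q) ∧ s         ≈⟨ ∨-cong (∧-distribʳ-∨ r p q)
                                                  (∧-distribʳ-∨ s p q) ⟩
      (p ∧ r ∨ q ∧ r) ∨ (p ∧ s ∨ q ∧ s) ≤⟨ ∨-monotonic (∨-monotonic refl q∧r≤⊥)
                                                       (∨-monotonic p∧s≤⊥ refl) ⟩
      (p ∧ r ∨ ⊥) ∨ (⊥ ∨ q ∧ s)         ≈⟨ ∨-cong (∨-identityʳ _) (∨-identityˡ _) ⟩
      p ∧ r ∨ q ∧ s                     ∎)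
    (∨-least (∧-monotonic (x≤x∨y p q) (x≤x∨y r s))
             (∧-monotonic (y≤x∨y p q) (y≤x∨y r s)))
    where
    q∧r≤⊥ : q ∧ r ≤ ⊥
    q∧r≤⊥ = trans (reflexive (∧-comm q r)) r∧q≤⊥

  ∨-interchange : ∀ {p q r s} → (p ∨ q) ∨ (r ∨ s) ≈ (p ∨ r) ∨ (q ∨ s)
  ∨-interchange {p} {q} {r} {s} = antisym (swap p q r s) (swap p r q s)
    where
    swap : ∀ p q r s → (p ∨ q) ∨ (r ∨ s) ≤ (p ∨ r) ∨ (q ∨ s)
    swap p q r s = ∨-least (∨-monotonic (x≤x∨y p r) (x≤x∨y q s))
                           (∨-monotonic (y≤x∨y p r) (y≤x∨y q s))

  ≤-∨-split : ∀ {u p q x y} → u ≤ p ∨ q → p ∧ u ≤ x → q ∧ u ≤ y → u ≤ x ∨ y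
  ≤-∨-split {u} {p} {q} {x} {y} u≤p∨q p∧u≤x q∧u≤y = begin
    u                 ≤⟨ ∧-greatest u≤p∨q refl ⟩
    (p ∨ q) ∧ u       ≈⟨ ∧-distribʳ-∨ u p q ⟩
    p ∧ u ∨ q ∧ u     ≤⟨ ∨-monotonic p∧u≤x q∧u≤y ⟩
    x ∨ y             ∎

module Z7Embedding {c ℓ₁ ℓ₂} (H : HeytingAlgebra c ℓ₁ ℓ₂) (a : HeytingAlgebra.Carrier H) where
  open HeytingAlgebra H
  open HeytingAlgebraLemmas H
  open import Relation.Binary.Lattice.Properties.HeytingAlgebra H
    using (x≤¬¬x; y≤x⇨y; ⇨-applyʳ; ⇨ˡ-contravariant; ⇨-cong)
  open import Relation.Binary.Lattice.Properties.MeetSemilattice meetSemilattice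
    using (∧-comm; ∧-cong; ∧-monotonic; ∧-idempotent; y≤x⇒x∧y≈y)
  open import Relation.Binary.Lattice.Properties.JoinSemilattice joinSemilattice
    using (∨-comm; ∨-cong; ∨-monotonic; ∨-idempotent; x≤y⇒x∨y≈y)
  open import Relation.Binary.Lattice.Properties.BoundedLattice boundedLattice
    using (∧-zeroˡ; ∧-zeroʳ; ∨-zeroˡ; ∨-zeroʳ)
  open import Relation.Binary.Lattice.Properties.BoundedJoinSemilattice boundedJoinSemilattice
    using () renaming (identityˡ to ∨-identityˡ; identityʳ to ∨-identityʳ)
  open import Relation.Binary.Lattice.Properties.BoundedMeetSemilattice boundedMeetSemilattice
    using () renaming (identityˡ to ∧-identityˡ; identityʳ to ∧-identityʳ)
  open import Relation.Binary.Reasoning.PartialOrder poset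

  ¬a ¬¬a w : Carrier
  ¬a  = neg H a
  ¬¬a = neg H ¬a
  w   = ¬a ∨ ¬¬a

  a≤¬¬a : a ≤ ¬¬a
  a≤¬¬a = x≤¬¬x a

  ¬a∧¬¬a≤⊥ : ¬a ∧ ¬¬a ≤ ⊥
  ¬a∧¬¬a≤⊥ = ⇨-applyʳ refl

  term₂ : Bool → Term
  term₂ false = ⊥ₜ
  term₂ true  = ¬ₜ var

  term₃ : Three → Term
  term₃ l0 = ⊥ₜ
  term₃ l1 = var
  term₃ l2 = ¬ₜ ¬ₜ var

  ι₂ : Bool → Carrier
  ι₂ b = eval H a (term₂ b)

  ι₃ : Three → Carrier
  ι₃ t = eval H a (term₃ t)

  ι : Z7 → Carrier
  ι (pt b t) = ι₂ b ∨ ι₃ t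
  ι top      = ⊤

  ι₂≤¬a : ∀ b → ι₂ b ≤ ¬a
  ι₂≤¬a false = minimum _
  ι₂≤¬a true  = refl

  ι₃≤¬¬a : ∀ t → ι₃ t ≤ ¬¬a
  ι₃≤¬¬a l0 = minimum _
  ι₃≤¬¬a l1 = a≤¬¬a
  ι₃≤¬¬a l2 = refl

  ι₂∧ι₃≤⊥ : ∀ b t → ι₂ b ∧ ι₃ t ≤ ⊥
  ι₂∧ι₃≤⊥ b t = trans (∧-monotonic (ι₂≤¬a b) (ι₃≤¬¬a t)) ¬a∧¬¬a≤⊥

  ι-pt≤w : ∀ b t → ι (pt b t) ≤ w
  ι-pt≤w b t = ∨-monotonic (ι₂≤¬a b) (ι₃≤¬¬a t)

  ¬a∧ι-pt : ∀ b t → ¬a ∧ ι (pt b t) ≈ ι₂ b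
  ¬a∧ι-pt b t = ∧-∨-disjointˡ ¬a∧¬¬a≤⊥ (ι₂≤¬a b) (ι₃≤¬¬a t)

  ¬¬a∧ι-pt : ∀ b t → ¬¬a ∧ ι (pt b t) ≈ ι₃ t
  ¬¬a∧ι-pt b t = ∧-∨-disjointʳ ¬a∧¬¬a≤⊥ (ι₂≤¬a b) (ι₃≤¬¬a t)

  ι₂-mono : ∀ {b c} → leq₂ b c ≡ true → ι₂ b ≤ ι₂ c
  ι₂-mono {false}        _  = minimum _
  ι₂-mono {true} {true}  _  = refl
  ι₂-mono {true} {false} ()

  ι₃-mono : ∀ {t d} → leq₃ t d ≡ true → ι₃ t ≤ ι₃ d
  ι₃-mono {l0}      _  = minimum _
  ι₃-mono {l1} {l1} _  = refl
  ι₃-mono {l1} {l2} _  = a≤¬¬a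
  ι₃-mono {l2} {l2} _  = refl
  ι₃-mono {l1} {l0} ()
  ι₃-mono {l2} {l0} ()
  ι₃-mono {l2} {l1} ()

  ι₂-∧ : ∀ b c → ι₂ (b ∧ᵇ c) ≈ ι₂ b ∧ ι₂ c
  ι₂-∧ false c     = Eq.sym (∧-zeroˡ _)
  ι₂-∧ true  false = Eq.sym (∧-zeroʳ _)
  ι₂-∧ true  true  = Eq.sym (∧-idempotent _)

  ι₂-∨ : ∀ b c → ι₂ (b ∨ᵇ c) ≈ ι₂ b ∨ ι₂ c
  ι₂-∨ false c     = Eq.sym (∨-identityˡ _)
  ι₂-∨ true  false = Eq.sym (∨-identityʳ _)
  ι₂-∨ true  true  = Eq.sym (∨-idempotent _)

  ι₃-min : ∀ t d → ι₃ (min₃ t d) ≈ ι₃ t ∧ ι₃ d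
  ι₃-min l0 d  = Eq.sym (∧-zeroˡ _)
  ι₃-min l1 l0 = Eq.sym (∧-zeroʳ _)
  ι₃-min l1 l1 = Eq.sym (∧-idempotent _)
  ι₃-min l1 l2 = Eq.sym (Eq.trans (∧-comm _ _) (y≤x⇒x∧y≈y a≤¬¬a))
  ι₃-min l2 d  = Eq.sym (y≤x⇒x∧y≈y (ι₃≤¬¬a d))

  ι₃-max : ∀ t d → ι₃ (max₃ t d) ≈ ι₃ t ∨ ι₃ d
  ι₃-max l0 d  = Eq.sym (∨-identityˡ _)
  ι₃-max l1 l0 = Eq.sym (∨-identityʳ _)
  ι₃-max l1 l1 = Eq.sym (∨-idempotent _)
  ι₃-max l1 l2 = Eq.sym (x≤y⇒x∨y≈y a≤¬¬a)
  ι₃-max l2 d  = Eq.sym (Eq.trans (∨-comm _ _) (x≤y⇒x∨y≈y (ι₃≤¬¬a d)))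

  ι₂-⇨ : ∀ b c → ι₂ (imp₂ b c) ≈ ¬a ∧ (ι₂ b ⇨ ι₂ c)
  ι₂-⇨ false c     = x≤y⇒p∧[x⇨y]≈p (minimum _)
  ι₂-⇨ true  true  = x≤y⇒p∧[x⇨y]≈p refl
  ι₂-⇨ true  false = antisym (minimum _) ¬a∧¬¬a≤⊥

  ι₃-⇨ : ∀ t d → ι₃ (imp₃ t d) ≈ ¬¬a ∧ (ι₃ t ⇨ ι₃ d)
  ι₃-⇨ l0 d  = x≤y⇒p∧[x⇨y]≈p (minimum _)
  ι₃-⇨ l1 l0 = antisym (minimum _) (trans (reflexive (∧-comm _ _)) ¬a∧¬¬a≤⊥)
  ι₃-⇨ l1 l1 = x≤y⇒p∧[x⇨y]≈p refl
  ι₃-⇨ l1 l2 = x≤y⇒p∧[x⇨y]≈p a≤¬¬a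
  ι₃-⇨ l2 l0 = antisym (minimum _) (⇨-applyʳ refl)
  ι₃-⇨ l2 l1 = antisym (∧-greatest a≤¬¬a y≤x⇨y) (⇨-applyʳ refl)
  ι₃-⇨ l2 l2 = x≤y⇒p∧[x⇨y]≈p refl

  ι-⊥ : ι botZ ≈ ⊥
  ι-⊥ = ∨-idempotent ⊥

  ι-definable : ∀ z → Σ Term (λ s → eval H a s ≈ ι z)
  ι-definable (pt b t) = term₂ b ∨ₜ term₃ t , Eq.refl
  ι-definable top      = ⊤ₜ , Eq.refl

  ι-∧ : ∀ x y → ι (meetZ x y) ≈ ι x ∧ ι y
  ι-∧ top      y        = Eq.sym (∧-identityˡ _)
  ι-∧ (pt b t) top      = Eq.sym (∧-identityʳ _)
  ι-∧ (pt b t) (pt c d) = begin-equality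
    ι₂ (b ∧ᵇ c) ∨ ι₃ (min₃ t d)    ≈⟨ ∨-cong (ι₂-∧ b c) (ι₃-min t d) ⟩
    ι₂ b ∧ ι₂ c ∨ ι₃ t ∧ ι₃ d      ≈⟨ ∧-∨-interchange-disjoint (ι₂∧ι₃≤⊥ b d) (ι₂∧ι₃≤⊥ c t) ⟨
    (ι₂ b ∨ ι₃ t) ∧ (ι₂ c ∨ ι₃ d)  ∎

  ι-∨ : ∀ x y → ι (joinZ x y) ≈ ι x ∨ ι y
  ι-∨ top      y        = Eq.sym (∨-zeroˡ _)
  ι-∨ (pt b t) top      = Eq.sym (∨-zeroʳ _)
  ι-∨ (pt b t) (pt c d) = begin-equality
    ι₂ (b ∨ᵇ c) ∨ ι₃ (max₃ t d)    ≈⟨ ∨-cong (ι₂-∨ b c) (ι₃-max t d) ⟩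
    (ι₂ b ∨ ι₂ c) ∨ (ι₃ t ∨ ι₃ d)  ≈⟨ ∨-interchange ⟩
    (ι₂ b ∨ ι₃ t) ∨ (ι₂ c ∨ ι₃ d)  ∎

  ι-pt⇨ι-pt≤ι₂⇨ι₂ : ∀ b t c d → ι (pt b t) ⇨ ι (pt c d) ≤ ι₂ b ⇨ ι₂ c
  ι-pt⇨ι-pt≤ι₂⇨ι₂ b t c d =
    ⇨-restrict (x≤x∨y _ _) (trans (∧-monotonic (ι₂≤¬a b) refl) (reflexive (¬a∧ι-pt c d)))

  ι-pt⇨ι-pt≤ι₃⇨ι₃ : ∀ b t c d → ι (pt b t) ⇨ ι (pt c d) ≤ ι₃ t ⇨ ι₃ d
  ι-pt⇨ι-pt≤ι₃⇨ι₃ b t c d =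
    ⇨-restrict (y≤x∨y _ _) (trans (∧-monotonic (ι₃≤¬¬a t) refl) (reflexive (¬¬a∧ι-pt c d)))

  ι-pt-⇨ : ∀ b t c d → ι (pt b t) ⇨ ι (pt c d) ≤ w →
           ι (pt (imp₂ b c) (imp₃ t d)) ≈ ι (pt b t) ⇨ ι (pt c d)
  ι-pt-⇨ b t c d h≤w = antisym (transpose-⇨ eval-≤) (≤-∨-split h≤w ¬a∧h≤ ¬¬a∧h≤)
    where
    i : Bool
    i = imp₂ b c

    j : Three
    j = imp₃ t d

    eval-≤ : ι (pt i j) ∧ ι (pt b t) ≤ ι (pt c d)
    eval-≤ = begin
      (ι₂ i ∨ ι₃ j) ∧ (ι₂ b ∨ ι₃ t)  ≈⟨ ∧-∨-interchange-disjoint (ι₂∧ι₃≤⊥ i t) (ι₂∧ι₃≤⊥ b j) ⟩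
      ι₂ i ∧ ι₂ b ∨ ι₃ j ∧ ι₃ t      ≤⟨ ∨-monotonic (relative-eval (ι₂-⇨ b c))
                                                    (relative-eval (ι₃-⇨ t d)) ⟩
      ι₂ c ∨ ι₃ d                    ∎
      where
      relative-eval : ∀ {u p x y} → u ≈ p ∧ (x ⇨ y) → u ∧ x ≤ y
      relative-eval u≈p∧[x⇨y] = transpose-∧ (trans (reflexive u≈p∧[x⇨y]) (x∧y≤y _ _))

    ¬a∧h≤ : ¬a ∧ (ι (pt b t) ⇨ ι (pt c d)) ≤ ι₂ i
    ¬a∧h≤ = trans (∧-monotonic refl (ι-pt⇨ι-pt≤ι₂⇨ι₂ b t c d))
                  (reflexive (Eq.sym (ι₂-⇨ b c)))

    ¬¬a∧h≤ : ¬¬a ∧ (ι (pt b t) ⇨ ι (pt c d)) ≤ ι₃ j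
    ¬¬a∧h≤ = trans (∧-monotonic refl (ι-pt⇨ι-pt≤ι₃⇨ι₃ b t c d))
                   (reflexive (Eq.sym (ι₃-⇨ t d)))

  ι₂-≰⇒ι₂⇨ι₂≤w : ∀ {b c} → leq₂ b c ≡ false → ι₂ b ⇨ ι₂ c ≤ w
  ι₂-≰⇒ι₂⇨ι₂≤w {true}  {false} _  = y≤x∨y _ _
  ι₂-≰⇒ι₂⇨ι₂≤w {false}         ()
  ι₂-≰⇒ι₂⇨ι₂≤w {true}  {true}  ()

  ι-pt-mono : ∀ b t c d → leq₂ b c ∧ᵇ leq₃ t d ≡ true → ι (pt b t) ≤ ι (pt c d)
  ι-pt-mono b t c d b,t≤c,d = ∨-monotonic (ι₂-mono {b} {c} (∧-conicalˡ _ _ b,t≤c,d))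
                                          (ι₃-mono {t} {d} (∧-conicalʳ (leq₂ b c) _ b,t≤c,d))

  InImage : Carrier → Set ℓ₁
  InImage u = Σ Z7 (λ z → u ≈ ι z)

  InImage-closed : ∀ {_∙_ : Carrier → Carrier → Carrier} (_⊙_ : Z7 → Z7 → Z7) →
                   _∙_ Preserves₂ _≈_ ⟶ _≈_ ⟶ _≈_ → (∀ x y → ι (x ⊙ y) ≈ ι x ∙ ι y) →
                   ∀ {u v} → InImage u → InImage v → InImage (u ∙ v)
  InImage-closed _⊙_ ∙-cong ι-∙ (x , u≈ιx) (y , v≈ιy) =
    x ⊙ y , Eq.trans (∙-cong u≈ιx v≈ιy) (Eq.sym (ι-∙ x y))

  module _ (¬¬a⇨a≤w : ¬¬a ⇨ a ≤ w) where

    ι₃-≰⇒ι₃⇨ι₃≤w : ∀ {t d} → leq₃ t d ≡ false → ι₃ t ⇨ ι₃ d ≤ w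
    ι₃-≰⇒ι₃⇨ι₃≤w {l1} {l0} _  = x≤x∨y _ _
    ι₃-≰⇒ι₃⇨ι₃≤w {l2} {l0} _  = trans (⇨ˡ-contravariant a≤¬¬a) (x≤x∨y _ _)
    ι₃-≰⇒ι₃⇨ι₃≤w {l2} {l1} _  = ¬¬a⇨a≤w
    ι₃-≰⇒ι₃⇨ι₃≤w {l0}      ()
    ι₃-≰⇒ι₃⇨ι₃≤w {l1} {l1} ()
    ι₃-≰⇒ι₃⇨ι₃≤w {l1} {l2} ()
    ι₃-≰⇒ι₃⇨ι₃≤w {l2} {l2} ()

    ι-pt⇨ι-pt≤w : ∀ b t c d → leq₂ b c ∧ᵇ leq₃ t d ≡ false →
                  ι (pt b t) ⇨ ι (pt c d) ≤ w
    ι-pt⇨ι-pt≤w b t c d b,t≰c,d with leq₂ b c in b≤c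
    ... | false = trans (ι-pt⇨ι-pt≤ι₂⇨ι₂ b t c d) (ι₂-≰⇒ι₂⇨ι₂≤w b≤c)
    ... | true  = trans (ι-pt⇨ι-pt≤ι₃⇨ι₃ b t c d) (ι₃-≰⇒ι₃⇨ι₃≤w b,t≰c,d)

    ι-⇨ : ∀ x y → ι (impZ x y) ≈ ι x ⇨ ι y
    ι-⇨ x        top      = Eq.sym (x≤y⇒x⇨y≈⊤ (maximum _))
    ι-⇨ top      (pt c d) = Eq.sym ⊤⇨x≈x
    ι-⇨ (pt b t) (pt c d) with leq₂ b c ∧ᵇ leq₃ t d in b,t≤c,d
    ... | true  = Eq.sym (x≤y⇒x⇨y≈⊤ (ι-pt-mono b t c d b,t≤c,d))
    ... | false = ι-pt-⇨ b t c d (ι-pt⇨ι-pt≤w b t c d b,t≤c,d)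

    eval-∈-image : ∀ s → InImage (eval H a s)
    eval-∈-image var      = pt false l1 , Eq.sym (∨-identityˡ a)
    eval-∈-image ⊥ₜ       = botZ , Eq.sym ι-⊥
    eval-∈-image ⊤ₜ       = top , Eq.refl
    eval-∈-image (s ∧ₜ t) = InImage-closed meetZ ∧-cong ι-∧ (eval-∈-image s) (eval-∈-image t)
    eval-∈-image (s ∨ₜ t) = InImage-closed joinZ ∨-cong ι-∨ (eval-∈-image s) (eval-∈-image t)
    eval-∈-image (s ⇨ₜ t) = InImage-closed impZ ⇨-cong ι-⇨ (eval-∈-image s) (eval-∈-image t)
    eval-∈-image (¬ₜ s)   = InImage-closed impZ ⇨-cong ι-⇨ (eval-∈-image s) (eval-∈-image ⊥ₜ)

    module _ (w≉⊤ : ¬ w ≈ ⊤) where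

      ⊤≰w : ¬ ⊤ ≤ w
      ⊤≰w ⊤≤w = w≉⊤ (antisym (maximum w) ⊤≤w)

      ⇨≤w⇒≰ : ∀ {x y} → x ⇨ y ≤ w → ¬ x ≤ y
      ⇨≤w⇒≰ x⇨y≤w x≤y = ⊤≰w (trans (reflexive (Eq.sym (x≤y⇒x⇨y≈⊤ x≤y))) x⇨y≤w)

      ι-pt≉⊤ : ∀ b t → ¬ ι (pt b t) ≈ ⊤
      ι-pt≉⊤ b t ι-pt≈⊤ = ⊤≰w (trans (reflexive (Eq.sym ι-pt≈⊤)) (ι-pt≤w b t))

      a≰⊥ : ¬ a ≤ ⊥
      a≰⊥ = ⇨≤w⇒≰ (x≤x∨y _ _)

      ¬a≰⊥ : ¬ ¬a ≤ ⊥
      ¬a≰⊥ = ⇨≤w⇒≰ (y≤x∨y _ _)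

      ¬¬a≰a : ¬ ¬¬a ≤ a
      ¬¬a≰a = ⇨≤w⇒≰ ¬¬a⇨a≤w

      ι₂-injective : ∀ {b c} → ι₂ b ≈ ι₂ c → b ≡ c
      ι₂-injective {false} {false} _ = ≡.refl
      ι₂-injective {true}  {true}  _ = ≡.refl
      ι₂-injective {true}  {false} e = contradiction (reflexive e) ¬a≰⊥
      ι₂-injective {false} {true}  e = contradiction (reflexive (Eq.sym e)) ¬a≰⊥

      ι₃-injective : ∀ {t d} → ι₃ t ≈ ι₃ d → t ≡ d
      ι₃-injective {l0} {l0} _ = ≡.refl
      ι₃-injective {l1} {l1} _ = ≡.refl
      ι₃-injective {l2} {l2} _ = ≡.refl
      ι₃-injective {l1} {l0} e = contradiction (reflexive e) a≰⊥
      ι₃-injective {l0} {l1} e = contradiction (reflexive (Eq.sym e)) a≰⊥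
      ι₃-injective {l2} {l0} e = contradiction (trans a≤¬¬a (reflexive e)) a≰⊥
      ι₃-injective {l0} {l2} e = contradiction (trans a≤¬¬a (reflexive (Eq.sym e))) a≰⊥
      ι₃-injective {l2} {l1} e = contradiction (reflexive e) ¬¬a≰a
      ι₃-injective {l1} {l2} e = contradiction (reflexive (Eq.sym e)) ¬¬a≰a

      ι-injective : ∀ x y → ι x ≈ ι y → x ≡ y
      ι-injective top      top      _ = ≡.refl
      ι-injective top      (pt c d) e = contradiction (Eq.sym e) (ι-pt≉⊤ c d)
      ι-injective (pt b t) top      e = contradiction e (ι-pt≉⊤ b t)
      ι-injective (pt b t) (pt c d) e = ≡.cong₂ pt
        (ι₂-injective (project (¬a∧ι-pt b t) (¬a∧ι-pt c d)))
        (ι₃-injective (project (¬¬a∧ι-pt b t) (¬¬a∧ι-pt c d)))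
        where
        project : ∀ {p u v} → p ∧ ι (pt b t) ≈ u → p ∧ ι (pt c d) ≈ v → u ≈ v
        project p∧x≈u p∧y≈v = Eq.trans (Eq.sym p∧x≈u) (Eq.trans (∧-cong Eq.refl e) p∧y≈v)

proposition14 : ∀ {c ℓ₁ ℓ₂} (H : HeytingAlgebra c ℓ₁ ℓ₂) (a : HeytingAlgebra.Carrier H) →
    HeytingAlgebra._≈_ H (HeytingAlgebra._⇨_ H (HeytingAlgebra._⇨_ H (neg H (neg H a)) a) (HeytingAlgebra._∨_ H (neg H (neg H a)) (neg H a))) (HeytingAlgebra.⊤ H) →
    ¬ HeytingAlgebra._≈_ H (HeytingAlgebra._∨_ H (neg H a) (neg H (neg H a))) (HeytingAlgebra.⊤ H) →
    GeneratedIsoZ7 H a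
proposition14 H a hyp w≉⊤ = record
  { f      = ι
  ; f-∧    = ι-∧
  ; f-∨    = ι-∨
  ; f-⇨    = ι-⇨ ¬¬a⇨a≤w
  ; f-⊤    = Eq.refl
  ; f-⊥    = ι-⊥
  ; f-inj  = ι-injective ¬¬a⇨a≤w w≉⊤
  ; f-onto = eval-∈-image ¬¬a⇨a≤w
  ; f-into = ι-definable
  }
  where
  open HeytingAlgebra H using (module Eq; _≤_; _⇨_; trans; reflexive)
  open HeytingAlgebraLemmas H using (x⇨y≈⊤⇒x≤y)
  open import Relation.Binary.Lattice.Properties.JoinSemilattice (HeytingAlgebra.joinSemilattice H)
    using (∨-comm)
  open Z7Embedding H a

  ¬¬a⇨a≤w : ¬¬a ⇨ a ≤ w
  ¬¬a⇨a≤w = trans (x⇨y≈⊤⇒x≤y hyp) (reflexive (∨-comm ¬¬a ¬a))
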